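{- For all $n\ge 2$, $\mathrm{r}_n(132)=\mathrm{r}_n(213)=\mathrm{r}_n(231)=\mathrm{r}_n(312)=2$.
   Context: $\mathcal{S}_n$ is the set of permutations of $[n]$, $\pi^r$ the reversal of $\pi$. A word $w$ contains $\rho\in\mathcal{S}_k$ if some subsequence $w_{i_1}\cdots w_{i_k}$ ($i_1<\cdots<i_k$) satisfies $w_{i_a}\le w_{i_b}$ iff $\rho_a\le\rho_b$; otherwise it avoids $\rho$. $\mathcal{R}_n=\{\pi\pi^r:\pi\in\mathcal{S}_n\}$ (concatenation of $\pi$ with its reversal), and $\mathrm{r}_n(\rho)$ is the number of members of $\mathcal{R}_n$ avoiding $\rho$. -}

module Defs where

open import Data.Nat using (ℕ; suc; _≤_; _<_)
open import Data.List using (List; length; reverse; _++_; lookup; upTo; map)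
open import Data.List.Relation.Binary.Sublist.Propositional using (_⊆_)
open import Data.List.Relation.Binary.Permutation.Propositional using (_↭_)
open import Data.List.Membership.Propositional using (_∈_)
open import Data.List.Relation.Unary.Unique.Propositional using (Unique)
open import Data.Fin using (Fin; cast)
open import Data.Product using (Σ; ∃; _×_)
open import Function.Bundles using (_⇔_)
open import Relation.Nullary using (¬_)
open import Relation.Binary.PropositionalEquality using (_≡_)

Word : Set
Word = List ℕ

[_] : ℕ → List ℕ
[ n ] = map suc (upTo n)

IsPerm : ℕ → Word → Set
IsPerm n π = π ↭ [ n ]

OrderIso : (u ρ : Word) → Set
OrderIso u ρ = Σ (length u ≡ length ρ) λ eq →
  (a b : Fin (length u)) →
    (lookup u a ≤ lookup u b) ⇔
    (lookup ρ (cast eq a) ≤ lookup ρ (cast eq b))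

Contains : Word → Word → Set
Contains w ρ = ∃ λ u → (u ⊆ w) × OrderIso u ρ

Avoids : Word → Word → Set
Avoids w ρ = ¬ Contains w ρ

InR : ℕ → Word → Set
InR n w = ∃ λ π → IsPerm n π × (w ≡ π ++ reverse π)

-- r_n(ρ) = m : the set of members of R_n avoiding ρ has exactly m elements,
-- witnessed by a duplicate-free list enumerating it.
r≡ : ℕ → Word → ℕ → Set
r≡ n ρ m = ∃ λ (L : List Word) → Unique L × (length L ≡ m) ×
  ((w : Word) → (w ∈ L) ⇔ (InR n w × Avoids w ρ))

-- In w = π πʳ every letter of π occurs on both sides of the centre, so any two distinct letters of
-- π occur in w in both orders. If w avoids 213, the first letter a of π is its least letter (for
-- n ≥ 3): otherwise 1 follows a in π, and either some letter b > a closes the 213 a 1 b in πʳ, or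
-- a = n and 2 1 n occurs with 2 before 1 in π πʳ and n the last letter of w. Peeling off least
-- letters leaves only the order of the last two letters free, and both resulting words avoid 213,
-- since a least letter standing at both ends of a word can be neither the 2 nor the 3 of an
-- occurrence. Reversal fixes every member of R_n and exchanges 213 with 312 and 231 with 132;
-- complementation x ↦ n+1-x permutes R_n and exchanges 213 with 231.

module Submission where

open import Defs
open import Data.Empty using (⊥; ⊥-elim)
open import Data.Fin.Patterns using (0F; 1F; 2F)
open import Data.List using (List; []; _∷_; _++_; reverse; map; upTo; applyUpTo; applyDownFrom)
open import Data.List.Properties
  using (++-assoc; ++-cancelʳ; unfold-reverse; reverse-++; reverse-involutive; reverse-map; map-++; map-∘;
         map-id-local; length-map; map-upTo; reverse-applyUpTo; ∷-injectiveˡ; ∷-injectiveʳ)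
open import Data.List.Membership.Propositional using (_∈_)
open import Data.List.Membership.Propositional.Properties using (∈-++⁻; ∈-map⁺; ∈-map⁻; ∈-upTo⁻)
open import Data.List.Relation.Unary.Any using (here; there)
import Data.List.Relation.Unary.Any.Properties as Any
open import Data.List.Relation.Unary.All as All using (All; []; _∷_)
import Data.List.Relation.Unary.All.Properties as Allₚ
open import Data.List.Relation.Unary.AllPairs using ([]; _∷_)
open import Data.List.Relation.Unary.Unique.Propositional using (Unique)
open import Data.List.Relation.Binary.Sublist.Propositional
  using (_⊆_; []; _∷_; _∷ʳ_; lookup; from∈; ⊆-refl; ⊆-trans)
open import Data.List.Relation.Binary.Sublist.Propositional.Properties
  using (++⁺; ++⁺ˡ; ++⁺ʳ; reverse⁺; reverse⁻; ∷ʳ⁻; map⁺)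
open import Data.List.Relation.Binary.Permutation.Propositional
  using (_↭_; prep; swap; ↭-refl; ↭-sym; ↭-trans; ↭-reflexive)
open import Data.List.Relation.Binary.Permutation.Propositional.Properties as Perm
  using (∈-resp-↭; drop-∷; ↭-empty-inv; ↭-singleton-inv; ↭-reverse)
open import Data.Nat using (ℕ; zero; suc; _+_; _∸_; _≤_; _<_; _≥_; s≤s; z<s; s<s; _≟_)
open import Data.Nat.Properties
  using (≤-refl; <-trans; <⇒≤; <⇒≱; ≰⇒>; <-irrefl; <-asym; ≤∧≢⇒<; n<1+n; m≤n+m; +-suc; +-identityʳ;
         m≤n⇒m≤1+n; ∸-monoʳ-<; m∸[m∸n]≡n)
open import Data.Product as Product using (_×_; _,_; ∃; proj₁; proj₂)
open import Data.Sum as Sum using (_⊎_; inj₁; inj₂)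
open import Function using (_∘_)
open import Function.Bundles using (_⇔_; mk⇔; Equivalence)
import Function.Properties.Equivalence as ⇔
open import Relation.Binary.PropositionalEquality
  using (_≡_; _≢_; refl; sym; trans; cong; cong₂; subst; module ≡-Reasoning)
open import Relation.Nullary using (¬_; yes; no)

open Equivalence using (to; from)

-- Occurrences of patterns of length three

Ternary : Set₁
Ternary = ℕ → ℕ → ℕ → Set

Occurs : Ternary → Word → Set
Occurs P w = ∃ λ x → ∃ λ y → ∃ λ z → (x ∷ y ∷ z ∷ []) ⊆ w × P x y z

Is213 Is231 Is132 Is312 : Ternary
Is213 x y z = y < x × x < z
Is231 x y z = z < x × x < y
Is132 x y z = x < z × z < y
Is312 x y z = y < z × z < x

contains-triple : ∀ {w p q r} → Contains w (p ∷ q ∷ r ∷ []) →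
  ∃ λ x → ∃ λ y → ∃ λ z → (x ∷ y ∷ z ∷ []) ⊆ w × OrderIso (x ∷ y ∷ z ∷ []) (p ∷ q ∷ r ∷ [])
contains-triple (x ∷ y ∷ z ∷ [] , s , iso) = x , y , z , s , iso
contains-triple ([] , _ , () , _)
contains-triple (_ ∷ [] , _ , () , _)
contains-triple (_ ∷ _ ∷ [] , _ , () , _)
contains-triple (_ ∷ _ ∷ _ ∷ _ ∷ _ , _ , () , _)

reflect-< : ∀ {a b c d} → (a ≤ b) ⇔ (c ≤ d) → d < c → b < a
reflect-< a≤b⇔c≤d d<c = ≰⇒> (<⇒≱ d<c ∘ to a≤b⇔c≤d)

Agree : ℕ → ℕ → ℕ → ℕ → Set
Agree x y p q = ((x ≤ y) ⇔ (p ≤ q)) × ((y ≤ x) ⇔ (q ≤ p))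

agree-< : ∀ {x y p q} → x < y → p < q → Agree x y p q
agree-< x<y p<q =
  mk⇔ (λ _ → <⇒≤ p<q) (λ _ → <⇒≤ x<y) ,
  mk⇔ (⊥-elim ∘ <⇒≱ x<y) (⊥-elim ∘ <⇒≱ p<q)

agree-> : ∀ {x y p q} → y < x → q < p → Agree x y p q
agree-> y<x q<p = Product.swap (agree-< y<x q<p)

≤-refl⇔≤-refl : ∀ {a b} → (a ≤ a) ⇔ (b ≤ b)
≤-refl⇔≤-refl = mk⇔ (λ _ → ≤-refl) (λ _ → ≤-refl)

orderIso-triple : ∀ {x y z p q r} → Agree x y p q → Agree x z p r → Agree y z q r →
  OrderIso (x ∷ y ∷ z ∷ []) (p ∷ q ∷ r ∷ [])
orderIso-triple (xy , yx) (xz , zx) (yz , zy) = refl , λ where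
  0F 0F → ≤-refl⇔≤-refl
  0F 1F → xy
  0F 2F → xz
  1F 0F → yx
  1F 1F → ≤-refl⇔≤-refl
  1F 2F → yz
  2F 0F → zx
  2F 1F → zy
  2F 2F → ≤-refl⇔≤-refl

contains⇔occurs : ∀ {p q r} {P : Ternary} →
  (∀ {x y z} → OrderIso (x ∷ y ∷ z ∷ []) (p ∷ q ∷ r ∷ []) → P x y z) →
  (∀ {x y z} → P x y z → OrderIso (x ∷ y ∷ z ∷ []) (p ∷ q ∷ r ∷ [])) →
  ∀ {w} → Contains w (p ∷ q ∷ r ∷ []) ⇔ Occurs P w
contains⇔occurs extract build = mk⇔
  (λ c → let x , y , z , s , iso = contains-triple c in x , y , z , s , extract iso)
  (λ (x , y , z , s , xyz) → _ , s , build xyz)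

1<2 : 1 < 2
1<2 = s<s z<s

2<3 : 2 < 3
2<3 = s<s (s<s z<s)

1<3 : 1 < 3
1<3 = s<s z<s

contains213⇔ : ∀ {w} → Contains w (2 ∷ 1 ∷ 3 ∷ []) ⇔ Occurs Is213 w
contains213⇔ = contains⇔occurs
  (λ { (refl , iso) → reflect-< (iso 0F 1F) 1<2 , reflect-< (iso 2F 0F) 2<3 })
  (λ (y<x , x<z) → orderIso-triple (agree-> y<x 1<2) (agree-< x<z 2<3) (agree-< (<-trans y<x x<z) 1<3))

contains231⇔ : ∀ {w} → Contains w (2 ∷ 3 ∷ 1 ∷ []) ⇔ Occurs Is231 w
contains231⇔ = contains⇔occurs
  (λ { (refl , iso) → reflect-< (iso 0F 2F) 1<2 , reflect-< (iso 1F 0F) 2<3 })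
  (λ (z<x , x<y) → orderIso-triple (agree-< x<y 2<3) (agree-> z<x 1<2) (agree-> (<-trans z<x x<y) 1<3))

contains132⇔ : ∀ {w} → Contains w (1 ∷ 3 ∷ 2 ∷ []) ⇔ Occurs Is132 w
contains132⇔ = contains⇔occurs
  (λ { (refl , iso) → reflect-< (iso 2F 0F) 1<2 , reflect-< (iso 1F 2F) 2<3 })
  (λ (x<z , z<y) → orderIso-triple (agree-< (<-trans x<z z<y) 1<3) (agree-< x<z 1<2) (agree-> z<y 2<3))

contains312⇔ : ∀ {w} → Contains w (3 ∷ 1 ∷ 2 ∷ []) ⇔ Occurs Is312 w
contains312⇔ = contains⇔occurs
  (λ { (refl , iso) → reflect-< (iso 2F 1F) 1<2 , reflect-< (iso 0F 2F) 2<3 })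
  (λ (y<z , z<x) → orderIso-triple (agree-> (<-trans y<z z<x) 1<3) (agree-> z<x 2<3) (agree-< y<z 1<2))

occurs-⊆ : ∀ {P u w} → u ⊆ w → Occurs P u → Occurs P w
occurs-⊆ u⊆w (x , y , z , s , xyz) = x , y , z , ⊆-trans s u⊆w , xyz

occurs-reverse : ∀ {P w} → Occurs P w → Occurs (λ x y z → P z y x) (reverse w)
occurs-reverse (x , y , z , s , xyz) = z , y , x , reverse⁺ s , xyz

occurs-map : ∀ {P Q : Ternary} (f : ℕ → ℕ) {w} →
  (∀ {x y z} → x ∈ w → y ∈ w → z ∈ w → P x y z → Q (f x) (f y) (f z)) →
  Occurs P w → Occurs Q (map f w)
occurs-map f PQ (x , y , z , s , xyz) =
  f x , f y , f z , map⁺ f s ,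
  PQ (lookup s (here refl)) (lookup s (there (here refl))) (lookup s (there (there (here refl)))) xyz

occurs⇔reverse : ∀ {P w} → Occurs P w ⇔ Occurs (λ x y z → P z y x) (reverse w)
occurs⇔reverse {P} {w} = mk⇔ occurs-reverse (subst (Occurs P) (reverse-involutive w) ∘ occurs-reverse)

-- Mirror words

mirror : Word → Word
mirror π = π ++ reverse π

mirror-∷ : ∀ a r → mirror (a ∷ r) ≡ a ∷ (mirror r ++ a ∷ [])
mirror-∷ a r = cong (a ∷_) (begin
  r ++ reverse (a ∷ r)       ≡⟨ cong (r ++_) (unfold-reverse a r) ⟩
  r ++ (reverse r ++ a ∷ []) ≡⟨ ++-assoc r (reverse r) (a ∷ []) ⟨
  mirror r ++ a ∷ []         ∎)
  where open ≡-Reasoning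

reverse-mirror : ∀ π → reverse (mirror π) ≡ mirror π
reverse-mirror π = trans (reverse-++ π (reverse π)) (cong (_++ reverse π) (reverse-involutive π))

map-mirror : ∀ (f : ℕ → ℕ) π → map f (mirror π) ≡ mirror (map f π)
map-mirror f π = trans (map-++ f π (reverse π)) (cong (map f π ++_) (reverse-map f π))

mirror-injective : ∀ π σ → mirror π ≡ mirror σ → π ≡ σ
mirror-injective [] [] _ = refl
mirror-injective (a ∷ r) (b ∷ s) eq with refl ← ∷-injectiveˡ eq =
  cong (a ∷_) (mirror-injective r s (++-cancelʳ (a ∷ []) (mirror r) (mirror s) (∷-injectiveʳ eq′)))
  where
  eq′ : a ∷ (mirror r ++ a ∷ []) ≡ a ∷ (mirror s ++ a ∷ [])
  eq′ = trans (sym (mirror-∷ a r)) (trans eq (mirror-∷ a s))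

∈-mirror⁻ : ∀ {v} π → v ∈ mirror π → v ∈ π
∈-mirror⁻ π v∈ with ∈-++⁻ π v∈
... | inj₁ v∈π = v∈π
... | inj₂ v∈πʳ = Any.reverse⁻ v∈πʳ

mirror-⊆-∷ : ∀ a r → mirror r ⊆ mirror (a ∷ r)
mirror-⊆-∷ a r = subst (mirror r ⊆_) (sym (mirror-∷ a r)) (a ∷ʳ ++⁺ʳ (a ∷ []) ⊆-refl)

⊆-pair : ∀ {A : Set} {x y : A} {xs} → x ∈ xs → y ∈ xs → x ≢ y → (x ∷ y ∷ []) ⊆ xs ⊎ (y ∷ x ∷ []) ⊆ xs
⊆-pair (here refl) (here refl) x≢y = ⊥-elim (x≢y refl)
⊆-pair (here refl) (there y∈) _ = inj₁ (refl ∷ from∈ y∈)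
⊆-pair (there x∈) (here refl) _ = inj₂ (refl ∷ from∈ x∈)
⊆-pair {xs = z ∷ _} (there x∈) (there y∈) x≢y = Sum.map (z ∷ʳ_) (z ∷ʳ_) (⊆-pair x∈ y∈ x≢y)

mirror-pair : ∀ {x y} r → x ∈ r → y ∈ r → x ≢ y → (x ∷ y ∷ []) ⊆ mirror r
mirror-pair r x∈ y∈ x≢y with ⊆-pair x∈ y∈ x≢y
... | inj₁ xy⊆r = ++⁺ʳ (reverse r) xy⊆r
... | inj₂ yx⊆r = ++⁺ˡ r (reverse⁺ yx⊆r)

⊆-unsnoc : ∀ {A : Set} {x y z a : A} ys → (x ∷ y ∷ z ∷ []) ⊆ ys ++ a ∷ [] → z ≢ a → (x ∷ y ∷ z ∷ []) ⊆ ys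
⊆-unsnoc {x = x} {y} {z} {a} ys s z≢a =
  reverse⁻ (∷ʳ⁻ z≢a (subst ((z ∷ y ∷ x ∷ []) ⊆_) (reverse-++ ys (a ∷ [])) (reverse⁺ s)))

↭-pair-inv : ∀ {A : Set} {p q : A} {π} → π ↭ p ∷ q ∷ [] → π ≡ p ∷ q ∷ [] ⊎ π ≡ q ∷ p ∷ []
↭-pair-inv {π = []} π↭ with () ← ↭-empty-inv (↭-sym π↭)
↭-pair-inv {π = a ∷ r} π↭ with ∈-resp-↭ π↭ (here refl)
... | here refl = inj₁ (cong (a ∷_) (↭-singleton-inv (drop-∷ π↭)))
... | there (here refl) = inj₂ (cong (a ∷_) (↭-singleton-inv (drop-∷ (↭-trans π↭ (swap _ _ ↭-refl)))))

-- Mirror words avoiding 213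

occurs213-head : ∀ {a u v r} → v ∈ r → u ∈ r → v < a → a < u → Occurs Is213 (mirror (a ∷ r))
occurs213-head {a} {u} {v} {r} v∈r u∈r v<a a<u =
  a , v , u , ++⁺ (refl ∷ from∈ v∈r) (from∈ (Any.reverse⁺ {xs = a ∷ r} (there u∈r))) , v<a , a<u

occurs213-ends : ∀ {a x y r} → x ∈ r → y ∈ r → x < y → y < a → Occurs Is213 (mirror (a ∷ r))
occurs213-ends {a} {x} {y} {r} x∈r y∈r x<y y<a =
  y , x , a , subst ((y ∷ x ∷ a ∷ []) ⊆_) (sym (mirror-∷ a r)) (a ∷ʳ ++⁺ yx⊆ (refl ∷ [])) , x<y , y<a
  where
  yx⊆ : (y ∷ x ∷ []) ⊆ mirror r
  yx⊆ = mirror-pair r y∈r x∈r (λ y≡x → <-irrefl (sym y≡x) x<y)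

avoids213-∷-least : ∀ {a r} → (∀ {v} → v ∈ a ∷ r → a ≤ v) →
  ¬ Occurs Is213 (mirror r) → ¬ Occurs Is213 (mirror (a ∷ r))
avoids213-∷-least {a} {r} least avoids (x , y , z , s , y<x , x<z)
  with subst ((x ∷ y ∷ z ∷ []) ⊆_) (mirror-∷ a r) s
... | refl ∷ _ = <⇒≱ y<x (least (∈-mirror⁻ (a ∷ r) (lookup s (there (here refl)))))
... | _ ∷ʳ s′ with z ≟ a
...   | yes refl = <⇒≱ x<z (least (∈-mirror⁻ (a ∷ r) (lookup s (here refl))))
...   | no z≢a = avoids (x , y , z , ⊆-unsnoc (mirror r) s′ z≢a , y<x , x<z)

∈-pair⁻ : ∀ {A : Set} {v p q : A} → v ∈ p ∷ q ∷ [] → v ≡ p ⊎ v ≡ q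
∈-pair⁻ (here v≡p) = inj₁ v≡p
∈-pair⁻ (there (here v≡q)) = inj₂ v≡q

avoids213-two-letters : ∀ {p q w} → (∀ {v} → v ∈ w → v ≡ p ⊎ v ≡ q) → ¬ Occurs Is213 w
avoids213-two-letters {p} {q} letters (x , y , z , s , y<x , x<z) =
  pigeonhole (letters (lookup s (here refl))) (letters (lookup s (there (here refl))))
             (letters (lookup s (there (there (here refl)))))
  where
  pigeonhole : x ≡ p ⊎ x ≡ q → y ≡ p ⊎ y ≡ q → z ≡ p ⊎ z ≡ q → ⊥
  pigeonhole (inj₁ refl) (inj₁ refl) _ = <-irrefl refl y<x
  pigeonhole (inj₂ refl) (inj₂ refl) _ = <-irrefl refl y<x
  pigeonhole (inj₁ refl) _ (inj₁ refl) = <-irrefl refl x<z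
  pigeonhole (inj₂ refl) _ (inj₂ refl) = <-irrefl refl x<z
  pigeonhole (inj₁ refl) (inj₂ refl) (inj₂ refl) = <-asym y<x x<z
  pigeonhole (inj₂ refl) (inj₁ refl) (inj₁ refl) = <-asym y<x x<z

interval : ℕ → ℕ → List ℕ
interval k zero = []
interval k (suc m) = suc k ∷ interval (suc k) m

∈-interval⁻ : ∀ {v} k m → v ∈ interval k m → k < v × v ≤ m + k
∈-interval⁻ k (suc m) (here refl) = ≤-refl , s≤s (m≤n+m k m)
∈-interval⁻ {v} k (suc m) (there v∈) with ∈-interval⁻ (suc k) m v∈
... | 1+k<v , v≤m+1+k = <⇒≤ 1+k<v , subst (v ≤_) (+-suc m k) v≤m+1+k

last-∈-interval : ∀ k m → suc m + k ∈ interval k (suc m)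
last-∈-interval k zero = here refl
last-∈-interval k (suc m) =
  there (subst (_∈ interval (suc k) (suc m)) (+-suc (suc m) k) (last-∈-interval (suc k) m))

[n]≡interval : ∀ n → [ n ] ≡ interval 0 n
[n]≡interval n = trans (map-upTo suc n) (applyUpTo-interval suc 0 n (λ _ → refl))
  where
  applyUpTo-interval : ∀ f k m → (∀ i → f i ≡ suc (k + i)) → applyUpTo f m ≡ interval k m
  applyUpTo-interval f k zero _ = refl
  applyUpTo-interval f k (suc m) f≗ = cong₂ _∷_
    (trans (f≗ 0) (cong suc (+-identityʳ k)))
    (applyUpTo-interval (f ∘ suc) (suc k) m (λ i → trans (f≗ (suc i)) (cong suc (+-suc k i))))

swapLast : ∀ {A : Set} → List A → List A
swapLast [] = []
swapLast (x ∷ []) = x ∷ []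
swapLast (x ∷ y ∷ []) = y ∷ x ∷ []
swapLast (x ∷ y ∷ z ∷ zs) = x ∷ swapLast (y ∷ z ∷ zs)

swapLast-↭ : ∀ {A : Set} (xs : List A) → swapLast xs ↭ xs
swapLast-↭ [] = ↭-refl
swapLast-↭ (x ∷ []) = ↭-refl
swapLast-↭ (x ∷ y ∷ []) = swap y x ↭-refl
swapLast-↭ (x ∷ y ∷ z ∷ zs) = prep x (swapLast-↭ (y ∷ z ∷ zs))

swapLast-interval-≢ : ∀ k j → swapLast (interval k (2 + j)) ≢ interval k (2 + j)
swapLast-interval-≢ k zero eq = <-irrefl (sym (∷-injectiveˡ eq)) (n<1+n (suc k))
swapLast-interval-≢ k (suc j) eq = swapLast-interval-≢ (suc k) j (∷-injectiveʳ eq)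

avoids213-interval : ∀ k j → ¬ Occurs Is213 (mirror (interval k (2 + j)))
avoids213-interval k zero = avoids213-two-letters (∈-pair⁻ ∘ ∈-mirror⁻ (interval k 2))
avoids213-interval k (suc j) =
  avoids213-∷-least (proj₁ ∘ ∈-interval⁻ k (3 + j)) (avoids213-interval (suc k) j)

avoids213-swapLast : ∀ k j → ¬ Occurs Is213 (mirror (swapLast (interval k (2 + j))))
avoids213-swapLast k zero = avoids213-two-letters (∈-pair⁻ ∘ ∈-mirror⁻ (swapLast (interval k 2)))
avoids213-swapLast k (suc j) =
  avoids213-∷-least (proj₁ ∘ ∈-interval⁻ k (3 + j) ∘ ∈-resp-↭ (swapLast-↭ (interval k (3 + j))))
    (avoids213-swapLast (suc k) j)

least-first : ∀ j k {a r} → a ∷ r ↭ interval k (3 + j) → ¬ Occurs Is213 (mirror (a ∷ r)) → a ≡ suc k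
least-first j k {a} {r} a∷r↭ avoids with a ≟ suc k
... | yes a≡1+k = a≡1+k
... | no a≢1+k = ⊥-elim (avoids occurrence)
  where
  top : ℕ
  top = 3 + j + k

  2+k<top : 2 + k < top
  2+k<top = s≤s (s≤s (s≤s (m≤n+m k j)))

  a-bounds : k < a × a ≤ top
  a-bounds = ∈-interval⁻ k (3 + j) (∈-resp-↭ a∷r↭ (here refl))

  ∈-rest : ∀ {v} → v ∈ interval k (3 + j) → v ≢ a → v ∈ r
  ∈-rest v∈ v≢a with ∈-resp-↭ (↭-sym a∷r↭) v∈
  ... | here v≡a = ⊥-elim (v≢a v≡a)
  ... | there v∈r = v∈r

  occurrence : Occurs Is213 (mirror (a ∷ r))
  occurrence with a ≟ top
  ... | yes refl =
    occurs213-ends (∈-rest (here refl) (a≢1+k ∘ sym))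
      (∈-rest (there (here refl)) (λ eq → <-irrefl eq 2+k<top)) (n<1+n (suc k)) 2+k<top
  ... | no a≢top =
    occurs213-head (∈-rest (here refl) (a≢1+k ∘ sym)) (∈-rest (last-∈-interval k (2 + j)) (a≢top ∘ sym))
      (≤∧≢⇒< (proj₁ a-bounds) (a≢1+k ∘ sym)) (≤∧≢⇒< (proj₂ a-bounds) a≢top)

classify213 : ∀ j k π → π ↭ interval k (2 + j) → ¬ Occurs Is213 (mirror π) →
  π ≡ interval k (2 + j) ⊎ π ≡ swapLast (interval k (2 + j))
classify213 zero k π π↭ _ = ↭-pair-inv π↭
classify213 (suc j) k [] π↭ _ with () ← ↭-empty-inv (↭-sym π↭)
classify213 (suc j) k (a ∷ r) π↭ avoids with refl ← least-first j k π↭ avoids =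
  Sum.map (cong (a ∷_)) (cong (a ∷_))
    (classify213 j (suc k) r (drop-∷ π↭) (avoids ∘ occurs-⊆ (mirror-⊆-∷ a r)))

r≡-pair : ∀ {n ρ} w₁ w₂ → w₁ ≢ w₂ → InR n w₁ × Avoids w₁ ρ → InR n w₂ × Avoids w₂ ρ →
  (∀ {w} → InR n w → Avoids w ρ → w ≡ w₁ ⊎ w ≡ w₂) → r≡ n ρ 2
r≡-pair {n} {ρ} w₁ w₂ w₁≢w₂ w₁-ok w₂-ok only =
  w₁ ∷ w₂ ∷ [] , ((w₁≢w₂ ∷ []) ∷ [] ∷ []) , refl , λ w → mk⇔ (listed w) unlisted
  where
  listed : ∀ w → w ∈ w₁ ∷ w₂ ∷ [] → InR n w × Avoids w ρ
  listed w (here refl) = w₁-ok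
  listed w (there (here refl)) = w₂-ok
  unlisted : ∀ {w} → InR n w × Avoids w ρ → w ∈ w₁ ∷ w₂ ∷ []
  unlisted (inR , avoids) with only inR avoids
  ... | inj₁ w≡w₁ = here w≡w₁
  ... | inj₂ w≡w₂ = there (here w≡w₂)

r-213 : ∀ j → r≡ (2 + j) (2 ∷ 1 ∷ 3 ∷ []) 2
r-213 j = r≡-pair (mirror ι) (mirror (swapLast ι))
  (swapLast-interval-≢ 0 j ∘ sym ∘ mirror-injective ι (swapLast ι))
  ((ι , ι↭[n] , refl) , avoids213-interval 0 j ∘ to contains213⇔)
  ((swapLast ι , ↭-trans (swapLast-↭ ι) ι↭[n] , refl) , avoids213-swapLast 0 j ∘ to contains213⇔)
  λ { (π , π↭[n] , refl) avoids → Sum.map (cong mirror) (cong mirror)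
        (classify213 j 0 π (↭-trans π↭[n] (↭-sym ι↭[n])) (avoids ∘ from contains213⇔)) }
  where
  ι : List ℕ
  ι = interval 0 (2 + j)
  ι↭[n] : ι ↭ [ 2 + j ]
  ι↭[n] = ↭-reflexive (sym ([n]≡interval (2 + j)))

-- Symmetries of R_n

unique-map-on : ∀ {A B : Set} {P : A → Set} {f : A → B} {xs} →
  (∀ {x y} → P x → P y → f x ≡ f y → x ≡ y) → All P xs → Unique xs → Unique (map f xs)
unique-map-on injective [] [] = []
unique-map-on injective (px ∷ pxs) (x≢xs ∷ unique) =
  Allₚ.map⁺ (All.zipWith (λ (x≢y , py) → x≢y ∘ injective px py) (x≢xs , pxs)) ∷
  unique-map-on injective pxs unique

r≡-transfer : ∀ {n ρ σ m} (φ : Word → Word) →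
  (∀ {w} → InR n w → InR n (φ w)) →
  (∀ {w} → InR n w → φ (φ w) ≡ w) →
  (∀ {w} → InR n w → Contains w ρ ⇔ Contains (φ w) σ) →
  r≡ n ρ m → r≡ n σ m
r≡-transfer {n} {ρ} {σ} φ closed involutive contains⇔ (L , unique , length≡ , members) =
  map φ L , unique-map-on injective (All.tabulate (proj₁ ∘ to (members _))) unique ,
  trans (length-map φ L) length≡ , λ w → mk⇔ image preimage
  where
  injective : ∀ {v w} → InR n v → InR n w → φ v ≡ φ w → v ≡ w
  injective inR-v inR-w φv≡φw = trans (sym (involutive inR-v)) (trans (cong φ φv≡φw) (involutive inR-w))
  image : ∀ {w} → w ∈ map φ L → InR n w × Avoids w σ
  image w∈ with v , v∈L , refl ← ∈-map⁻ φ w∈ with inR , avoids ← to (members v) v∈L =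
    closed inR , avoids ∘ from (contains⇔ inR)
  preimage : ∀ {w} → InR n w × Avoids w σ → w ∈ map φ L
  preimage {w} (inR , avoids) =
    subst (_∈ map φ L) (involutive inR) (∈-map⁺ φ (from (members (φ w)) (closed inR , avoids′)))
    where
    avoids′ : Avoids (φ w) ρ
    avoids′ = avoids ∘ subst (λ v → Contains v σ) (involutive inR) ∘ to (contains⇔ (closed inR))

InR-reverse : ∀ {n w} → InR n w → reverse w ≡ w
InR-reverse (π , _ , refl) = reverse-mirror π

contains231⇔reverse132 : ∀ {w} → Contains w (2 ∷ 3 ∷ 1 ∷ []) ⇔ Contains (reverse w) (1 ∷ 3 ∷ 2 ∷ [])
contains231⇔reverse132 = ⇔.trans contains231⇔ (⇔.trans occurs⇔reverse (⇔.sym contains132⇔))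

contains213⇔reverse312 : ∀ {w} → Contains w (2 ∷ 1 ∷ 3 ∷ []) ⇔ Contains (reverse w) (3 ∷ 1 ∷ 2 ∷ [])
contains213⇔reverse312 = ⇔.trans contains213⇔ (⇔.trans occurs⇔reverse (⇔.sym contains312⇔))

r≡-reverse : ∀ {n ρ σ m} → (∀ {w} → Contains w ρ ⇔ Contains (reverse w) σ) → r≡ n ρ m → r≡ n σ m
r≡-reverse {ρ = ρ} {σ} ρ⇔σ = r≡-transfer {ρ = ρ} {σ} reverse
  (λ inR → subst (InR _) (sym (InR-reverse inR)) inR) (λ {w} _ → reverse-involutive w) (λ _ → ρ⇔σ)

map-complement-[n] : ∀ n → map (suc n ∸_) [ n ] ≡ reverse [ n ]
map-complement-[n] n = begin
  map (suc n ∸_) (map suc (upTo n)) ≡⟨ map-∘ (upTo n) ⟨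
  map (n ∸_) (upTo n)               ≡⟨ map-upTo (n ∸_) n ⟩
  applyUpTo (n ∸_) n                ≡⟨ applyUpTo-∸ n ⟩
  applyDownFrom suc n               ≡⟨ reverse-applyUpTo suc n ⟨
  reverse (applyUpTo suc n)         ≡⟨ cong reverse (map-upTo suc n) ⟨
  reverse (map suc (upTo n))        ∎
  where
  open ≡-Reasoning
  applyUpTo-∸ : ∀ n → applyUpTo (n ∸_) n ≡ applyDownFrom suc n
  applyUpTo-∸ zero = refl
  applyUpTo-∸ (suc n) = cong (suc n ∷_) (applyUpTo-∸ n)

InR-letter-≤ : ∀ {n w v} → InR n w → v ∈ w → v ≤ n
InR-letter-≤ (π , π↭[n] , refl) v∈w
  with _ , i∈ , refl ← ∈-map⁻ suc (∈-resp-↭ π↭[n] (∈-mirror⁻ π v∈w)) = ∈-upTo⁻ i∈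

InR-complement : ∀ {n w} → InR n w → InR n (map (suc n ∸_) w)
InR-complement {n} (π , π↭[n] , refl) =
  map (suc n ∸_) π ,
  ↭-trans (Perm.map⁺ (suc n ∸_) π↭[n]) (↭-trans (↭-reflexive (map-complement-[n] n)) (↭-reverse [ n ])) ,
  map-mirror (suc n ∸_) π

complement-involutive : ∀ {n w} → InR n w → map (suc n ∸_) (map (suc n ∸_) w) ≡ w
complement-involutive {n} {w} inR =
  trans (sym (map-∘ w)) (map-id-local (All.tabulate (m∸[m∸n]≡n ∘ m≤n⇒m≤1+n ∘ InR-letter-≤ inR)))

complement-< : ∀ {n w x y} → InR n w → y ∈ w → x < y → suc n ∸ y < suc n ∸ x
complement-< inR y∈w x<y = ∸-monoʳ-< x<y (m≤n⇒m≤1+n (InR-letter-≤ inR y∈w))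

occurs213⇒complement231 : ∀ {n w} → InR n w → Occurs Is213 w → Occurs Is231 (map (suc n ∸_) w)
occurs213⇒complement231 inR =
  occurs-map _ λ x∈ _ z∈ (y<x , x<z) → complement-< inR z∈ x<z , complement-< inR x∈ y<x

occurs231⇒complement213 : ∀ {n w} → InR n w → Occurs Is231 w → Occurs Is213 (map (suc n ∸_) w)
occurs231⇒complement213 inR =
  occurs-map _ λ x∈ y∈ _ (z<x , x<y) → complement-< inR y∈ x<y , complement-< inR x∈ z<x

contains213⇔complement231 : ∀ {n w} → InR n w →
  Contains w (2 ∷ 1 ∷ 3 ∷ []) ⇔ Contains (map (suc n ∸_) w) (2 ∷ 3 ∷ 1 ∷ [])
contains213⇔complement231 inR = mk⇔
  (from contains231⇔ ∘ occurs213⇒complement231 inR ∘ to contains213⇔)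
  (from contains213⇔ ∘ subst (Occurs Is213) (complement-involutive inR) ∘
   occurs231⇒complement213 (InR-complement inR) ∘ to contains231⇔)

r-231 : ∀ j → r≡ (2 + j) (2 ∷ 3 ∷ 1 ∷ []) 2
r-231 j = r≡-transfer (map (suc (2 + j) ∸_))
  InR-complement complement-involutive contains213⇔complement231 (r-213 j)

proposition8 : (n : ℕ) → n ≥ 2 →
    r≡ n (1 ∷ 3 ∷ 2 ∷ []) 2 × r≡ n (2 ∷ 1 ∷ 3 ∷ []) 2 ×
    r≡ n (2 ∷ 3 ∷ 1 ∷ []) 2 × r≡ n (3 ∷ 1 ∷ 2 ∷ []) 2
proposition8 (suc zero) (s≤s ())
proposition8 (suc (suc j)) _ =
  r≡-reverse contains231⇔reverse132 (r-231 j) , r-213 j ,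
  r-231 j , r≡-reverse contains213⇔reverse312 (r-213 j)
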